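{- For every integer $s\ge3$, $\mathcal{X}(s)\subseteq\mathcal{P}(4)\cap\mathcal{Q}(4,1)$.
   Context: A connected dominating set of $G$ is a set $D$ such that every vertex is in $D$ or adjacent to a vertex of $D$ and $G[D]$ is connected; $\gamma_c(G)$ is its minimum size, and a minimum one is a $\gamma_c$-set. $G$ is $k$-$\gamma_c$-critical if $\gamma_c(G)=k$ and $\gamma_c(G+uv)<k$ for all non-adjacent $u,v$. For $\ell\ge0$, $G$ is $\ell$-factor critical if $G-S$ has a perfect matching for every set $S$ of $\ell$ vertices. $\mathcal{P}(k)$: a $k$-$\gamma_c$-critical graph $G$ belongs to $\mathcal{P}(k)$ if it has a maximal complete subgraph $H$ with at least two vertices such that (i) for every vertex $x$ of $G$ there is a $\gamma_c$-set $D$ of $G$ with $x\in D$ and $D\cap V(H)\ne\emptyset$; (ii) for every pair of non-adjacent vertices $x,y$ there is a connected dominating set $D'_{xy}$ of $G+xy$ with $|D'_{xy}|<k$ and $D'_{xy}\cap V(H)\ne\emptyset$. $\mathcal{Q}(k,\ell)$: the class of $k$-$\gamma_c$-critical graphs with minimum degree at least $\ell+1$ that are not $\ell$-factor critical. $\mathcal{X}(s)$: the graph on disjoint vertex sets $A=\{a_1,\dots,a_s\}$, $B=\{b_1,\dots,b_s\}$, $Y=\{y_1,\dots,y_s\}$ where $Y$ induces a complete graph, and for each $i$, $a_i$ is adjacent to every $b_j$ with $j\ne i$ and every $y_j$ with $j\neq i$; there are no other edges. -}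

module Defs where

open import Data.Nat using (ℕ; zero; suc; _*_; _<_; _≤_)
open import Data.Fin using (Fin; zero; suc; remQuot; _≟_)
open import Data.Fin.Subset using (Subset; _∈_; _∉_; ∣_∣; Nonempty; _∩_)
open import Data.Bool using (Bool; true; false; _∨_; _∧_; not)
open import Data.Product using (Σ; _×_; _,_)
open import Data.Sum using (_⊎_)
open import Data.Vec using (tabulate)
open import Relation.Nullary using (¬_)
open import Relation.Nullary.Decidable using (⌊_⌋)
open import Relation.Binary.PropositionalEquality using (_≡_; _≢_)

Graph : ℕ → Set
Graph n = Fin n → Fin n → Bool

addEdge : ∀ {n} → Graph n → Fin n → Fin n → Graph n
addEdge G u v a b = G a b ∨ ((⌊ a ≟ u ⌋ ∧ ⌊ b ≟ v ⌋) ∨ (⌊ a ≟ v ⌋ ∧ ⌊ b ≟ u ⌋))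

module _ {n : ℕ} (G : Graph n) where

  Adj : Fin n → Fin n → Set
  Adj u v = G u v ≡ true

  NonAdj : Fin n → Fin n → Set
  NonAdj u v = u ≢ v × G u v ≡ false

  data Reach (D : Subset n) : Fin n → Fin n → Set where
    here : ∀ {u} → u ∈ D → Reach D u u
    step : ∀ {u v w} → u ∈ D → Adj u v → Reach D v w → Reach D u w

  Dominating : Subset n → Set
  Dominating D = ∀ v → v ∈ D ⊎ Σ (Fin n) (λ u → u ∈ D × Adj v u)

  InducedConnected : Subset n → Set
  InducedConnected D = ∀ u v → u ∈ D → v ∈ D → Reach D u v

  IsCDS : Subset n → Set
  IsCDS D = Dominating D × InducedConnected D

  GammaC≡ : ℕ → Set
  GammaC≡ k = Σ (Subset n) (λ D → IsCDS D × ∣ D ∣ ≡ k)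
            × (∀ D → IsCDS D → k ≤ ∣ D ∣)

  IsGammaCSet : Subset n → Set
  IsGammaCSet D = IsCDS D × (∀ D' → IsCDS D' → ∣ D ∣ ≤ ∣ D' ∣)


  IsClique : Subset n → Set
  IsClique H = ∀ u v → u ∈ H → v ∈ H → u ≢ v → Adj u v

  IsMaximalClique : Subset n → Set
  IsMaximalClique H = IsClique H × (∀ w → w ∉ H → ¬ (∀ u → u ∈ H → Adj w u))

  degree : Fin n → ℕ
  degree v = ∣ tabulate (G v) ∣

  MinDegreeAtLeast : ℕ → Set
  MinDegreeAtLeast d = ∀ v → d ≤ degree v

  HasPerfectMatchingAvoiding : Subset n → Set
  HasPerfectMatchingAvoiding S =
    Σ (Fin n → Fin n → Bool) λ M →
      (∀ u v → M u v ≡ M v u)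
    × (∀ u v → M u v ≡ true → Adj u v × u ∉ S × v ∉ S)
    × (∀ v → v ∉ S → Σ (Fin n) (λ u → M v u ≡ true × (∀ w → M v w ≡ true → w ≡ u)))

  FactorCritical : ℕ → Set
  FactorCritical ℓ = ∀ S → ∣ S ∣ ≡ ℓ → HasPerfectMatchingAvoiding S

Critical : ∀ {n} → Graph n → ℕ → Set
Critical {n} G k = GammaC≡ G k
             × (∀ u v → NonAdj G u v →
                  Σ ℕ (λ k' → k' < k × GammaC≡ (addEdge G u v) k'))

InP : ∀ {n} → ℕ → Graph n → Set
InP {n} k G =
  Critical G k ×
  Σ (Subset n) λ H →
      IsMaximalClique G H
    × 2 ≤ ∣ H ∣
    × (∀ x → Σ (Subset n) (λ D → IsGammaCSet G D × x ∈ D × Nonempty (D ∩ H)))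
    × (∀ x y → NonAdj G x y →
         Σ (Subset n) (λ D → IsCDS (addEdge G x y) D × ∣ D ∣ < k × Nonempty (D ∩ H)))

InQ : ∀ {n} → ℕ → ℕ → Graph n → Set
InQ k ℓ G = Critical G k × MinDegreeAtLeast G (suc ℓ) × ¬ FactorCritical G ℓ

-- X(s): vertex (p , i) with p = 0 ↦ a_i, p = 1 ↦ b_i, p = 2 ↦ y_i
private
  ne : ∀ {s} → Fin s → Fin s → Bool
  ne i j = not ⌊ i ≟ j ⌋

xadj : ∀ {s} → Fin 3 → Fin s → Fin 3 → Fin s → Bool
xadj zero i (suc zero) j = ne i j
xadj zero i (suc (suc zero)) j = ne i j
xadj (suc zero) i zero j = ne i j
xadj (suc (suc zero)) i zero j = ne i j
xadj (suc (suc zero)) i (suc (suc zero)) j = ne i j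
xadj _ _ _ _ = false

X : (s : ℕ) → Graph (3 * s)
X s u v with remQuot {3} s u | remQuot {3} s v
... | (p , i) | (q , j) = xadj p i q j

-- Write vertices of X(s) as vertex p i (kind p ∈ {a, b, y}, index i < s);
-- two vertices are joined only if their indices differ.  The proof has four
-- ingredients.
--  * γ_c(X(s)) = 4.  The path b_i ~ a_j ~ y_k ~ a_i (i, j, k distinct) is a
--    connected dominating set.  Conversely, dominating the b's forces two
--    vertices a_i, a_k into any CDS, connecting them forces an exit x of a_i,
--    and a fourth member comes from a second exit or from dominating a_(index x).
--  * Criticality.  For a non-edge uv, a 3-vertex CDS of X(s) + uv is built
--    around a pair {a_i, y_k}, which dominates everything except a_k and b_i.
--    The bound γ_c(X(s) + uv) ≥ 3 is a general fact: a graph in which every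
--    vertex misses two vertices, every edge misses two vertices, and the pair
--    uv misses one, keeps "no dominating vertex or edge" after adding uv.
--  * The clique {y_0, …, y_(s-1)} is maximal, meets the standard γ_c-sets
--    (which cover every vertex) and the 3-vertex sets above: this is P(4).
--  * Minimum degree 2, and X(s) − a_0 has no perfect matching since the s
--    b's could only be matched into the s − 1 remaining a's: this is Q(4, 1).

module Submission where

open import Defs
open import Data.Nat using (ℕ; zero; suc; _+_; _*_; _≤_; _<_; z≤n; s≤s)
open import Data.Nat.Properties using (≤-trans; ≤-reflexive; ≤-antisym; +-suc; n≤1+n; <-irrefl; module ≤-Reasoning)
open import Data.Fin using (Fin; zero; suc; _≟_; combine; remQuot; punchOut)
open import Data.Fin.Properties
  using (remQuot-combine; combine-remQuot; combine-injectiveˡ; combine-injectiveʳ; punchOut-injective; injective⇒≤)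
open import Data.Fin.Subset using (Subset; _∈_; _∉_; ∣_∣; Nonempty; _∩_; _∪_; ⁅_⁆; _-_) renaming (⊥ to ∅)
open import Data.Fin.Subset.Properties
  using (∉⊥; ∣⊥∣≡0; ∣⁅x⁆∣≡1; x∈⁅x⁆; x∈⁅y⁆⇒x≡y; x≢y⇒x∉⁅y⁆; x∈p∪q⁺; x∈p∪q⁻; x∈p∩q⁺;
         x∈p∧x≢y⇒x∈p-y; x∈p⇒∣p-x∣<∣p∣)
open import Data.Bool using (Bool; true; false; _∧_; not)
import Data.Bool as Bool
open import Data.Bool.Properties using (∨-zeroʳ)
open import Data.List using (List; []; _∷_; length; map; allFin)
open import Data.Vec using ([]; _∷_; tabulate)
open import Data.Vec.Properties using (lookup∘tabulate; lookup⇒[]=)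
open import Data.List.Relation.Unary.Any using (here; there)
open import Data.List.Relation.Unary.All as All using (All; []; _∷_)
open import Data.List.Relation.Unary.AllPairs using ([]; _∷_)
open import Data.List.Relation.Unary.Linked using (Linked; []; [-]; _∷_)
open import Data.List.Relation.Unary.Unique.Propositional using (Unique)
open import Data.List.Membership.Propositional using () renaming (_∈_ to _∈ₗ_)
open import Data.List.Membership.Propositional.Properties using (∈-map⁺; ∈-map⁻; ∈-allFin)
open import Data.Product using (Σ; _×_; _,_; proj₁; proj₂; swap)
open import Data.Sum using (_⊎_; inj₁; inj₂)
open import Data.Empty using (⊥-elim)
open import Relation.Nullary using (¬_; Dec; yes; no)
open import Relation.Nullary.Decidable using (⌊_⌋; _⊎-dec_)
open import Relation.Binary.PropositionalEquality
  using (_≡_; _≢_; refl; sym; trans; cong; cong₂; subst; ≢-sym; module ≡-Reasoning)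

false≢true : false ≢ true
false≢true ()

⟦_⟧ : ∀ {n} → List (Fin n) → Subset n
⟦ [] ⟧     = ∅
⟦ x ∷ xs ⟧ = ⁅ x ⁆ ∪ ⟦ xs ⟧

module _ {n : ℕ} {x : Fin n} where

  ∈⟦⟧⁺ : ∀ {xs} → x ∈ₗ xs → x ∈ ⟦ xs ⟧
  ∈⟦⟧⁺ (here refl) = x∈p∪q⁺ (inj₁ (x∈⁅x⁆ x))
  ∈⟦⟧⁺ (there x∈xs) = x∈p∪q⁺ (inj₂ (∈⟦⟧⁺ x∈xs))

  ∈⟦⟧⁻ : ∀ xs → x ∈ ⟦ xs ⟧ → x ∈ₗ xs
  ∈⟦⟧⁻ [] x∈∅ = ⊥-elim (∉⊥ x∈∅)
  ∈⟦⟧⁻ (y ∷ ys) x∈ with x∈p∪q⁻ ⁅ y ⁆ ⟦ ys ⟧ x∈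
  ... | inj₁ x∈⁅y⁆ = here (x∈⁅y⁆⇒x≡y y x∈⁅y⁆)
  ... | inj₂ x∈ys  = there (∈⟦⟧⁻ ys x∈ys)

∣∪∣≤ : ∀ {n} (p q : Subset n) → ∣ p ∪ q ∣ ≤ ∣ p ∣ + ∣ q ∣
∣∪∣≤ []           []           = z≤n
∣∪∣≤ (true ∷ p)   (true ∷ q)   =
  s≤s (≤-trans (≤-trans (∣∪∣≤ p q) (n≤1+n _)) (≤-reflexive (sym (+-suc ∣ p ∣ ∣ q ∣))))
∣∪∣≤ (true ∷ p)   (false ∷ q)  = s≤s (∣∪∣≤ p q)
∣∪∣≤ (false ∷ p)  (true ∷ q)   =
  ≤-trans (s≤s (∣∪∣≤ p q)) (≤-reflexive (sym (+-suc ∣ p ∣ ∣ q ∣)))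
∣∪∣≤ (false ∷ p)  (false ∷ q)  = ∣∪∣≤ p q

∣⟦⟧∣≤length : ∀ {n} (xs : List (Fin n)) → ∣ ⟦ xs ⟧ ∣ ≤ length xs
∣⟦⟧∣≤length {n} [] = ≤-reflexive (∣⊥∣≡0 n)
∣⟦⟧∣≤length (x ∷ xs) = begin
  ∣ ⁅ x ⁆ ∪ ⟦ xs ⟧ ∣       ≤⟨ ∣∪∣≤ ⁅ x ⁆ ⟦ xs ⟧ ⟩
  ∣ ⁅ x ⁆ ∣ + ∣ ⟦ xs ⟧ ∣   ≡⟨ cong (_+ ∣ ⟦ xs ⟧ ∣) (∣⁅x⁆∣≡1 x) ⟩
  suc ∣ ⟦ xs ⟧ ∣           ≤⟨ s≤s (∣⟦⟧∣≤length xs) ⟩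
  suc (length xs)          ∎
  where open ≤-Reasoning

unique-members≤ : ∀ {n} {p : Subset n} (xs : List (Fin n)) → Unique xs → All (_∈ p) xs → length xs ≤ ∣ p ∣
unique-members≤ [] _ _ = z≤n
unique-members≤ {p = p} (x ∷ xs) (x≢xs ∷ xs-unique) (x∈p ∷ xs⊆p) =
  ≤-trans (s≤s (unique-members≤ xs xs-unique xs⊆p-x)) (x∈p⇒∣p-x∣<∣p∣ x∈p)
  where
  xs⊆p-x : All (_∈ p - x) xs
  xs⊆p-x = All.zipWith (λ (x≢y , y∈p) → x∈p∧x≢y⇒x∈p-y y∈p (≢-sym x≢y)) (x≢xs , xs⊆p)

three-members : ∀ {n} {p : Subset n} {a b c} → a ∈ p → b ∈ p → c ∈ p
              → a ≢ b → a ≢ c → b ≢ c → 3 ≤ ∣ p ∣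
three-members a∈p b∈p c∈p a≢b a≢c b≢c =
  unique-members≤ (_ ∷ _ ∷ _ ∷ [])
    ((a≢b ∷ a≢c ∷ []) ∷ (b≢c ∷ []) ∷ [] ∷ [])
    (a∈p ∷ b∈p ∷ c∈p ∷ [])

four-members : ∀ {n} {p : Subset n} {a b c d} → a ∈ p → b ∈ p → c ∈ p → d ∈ p
             → a ≢ b → a ≢ c → a ≢ d → b ≢ c → b ≢ d → c ≢ d → 4 ≤ ∣ p ∣
four-members a∈p b∈p c∈p d∈p a≢b a≢c a≢d b≢c b≢d c≢d =
  unique-members≤ (_ ∷ _ ∷ _ ∷ _ ∷ [])
    ((a≢b ∷ a≢c ∷ a≢d ∷ []) ∷ (b≢c ∷ b≢d ∷ []) ∷ (c≢d ∷ []) ∷ [] ∷ [])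
    (a∈p ∷ b∈p ∷ c∈p ∷ d∈p ∷ [])

module _ {n : ℕ} (G : Graph n) where

  Symmetric : Set
  Symmetric = ∀ {u v} → Adj G u v → Adj G v u

  Loopless : Set
  Loopless = ∀ v → ¬ Adj G v v

  Dom : Fin n → Fin n → Set
  Dom u v = v ≡ u ⊎ Adj G v u

  dom? : ∀ u v → Dec (Dom u v)
  dom? u v = (v ≟ u) ⊎-dec (G v u Bool.≟ true)

  DominatedBy : Subset n → Fin n → Set
  DominatedBy D v = v ∈ D ⊎ Σ (Fin n) λ u → u ∈ D × Adj G v u

  dominated : ∀ {D u v} → u ∈ D → Dom u v → DominatedBy D v
  dominated u∈D (inj₁ refl) = inj₁ u∈D
  dominated u∈D (inj₂ vu) = inj₂ (_ , u∈D , vu)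

  dominator : ∀ {D} → Dominating G D → ∀ v → Σ (Fin n) λ u → u ∈ D × Dom u v
  dominator dom v with dom v
  ... | inj₁ v∈D = v , v∈D , inj₁ refl
  ... | inj₂ (u , u∈D , vu) = u , u∈D , inj₂ vu

  other-dominator : ∀ {p q w} → ¬ Dom p w → Dom q w → q ≢ p
  other-dominator ¬pw qw refl = ¬pw qw

  Undominated₂ : Fin n → Fin n → Fin n → Set
  Undominated₂ p q m = ¬ Dom p m × ¬ Dom q m

  VertexMissesTwo : Fin n → Set
  VertexMissesTwo p = Σ (Fin n) λ m₁ → Σ (Fin n) λ m₂ → m₁ ≢ m₂ × ¬ Dom p m₁ × ¬ Dom p m₂

  MissOne MissTwo : Fin n → Fin n → Set
  MissOne p q = Σ (Fin n) (Undominated₂ p q)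
  MissTwo p q = Σ (Fin n) λ m₁ → Σ (Fin n) λ m₂ →
                m₁ ≢ m₂ × Undominated₂ p q m₁ × Undominated₂ p q m₂

  miss-one-swap : ∀ {p q} → MissOne p q → MissOne q p
  miss-one-swap (m , und) = m , swap und

  miss-two-swap : ∀ {p q} → MissTwo p q → MissTwo q p
  miss-two-swap (m₁ , m₂ , m₁≢m₂ , und₁ , und₂) = m₁ , m₂ , m₁≢m₂ , swap und₁ , swap und₂

  reach-start : ∀ {D u v} → Reach G D u v → u ∈ D
  reach-start (here u∈D) = u∈D
  reach-start (step u∈D _ _) = u∈D

  first-step : ∀ {D u v} → Reach G D u v → u ≢ v → Σ (Fin n) λ x → x ∈ D × Adj G u x
  first-step (here _) u≢u = ⊥-elim (u≢u refl)
  first-step (step _ ux xv) _ = _ , reach-start xv , ux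

  reach-++ : ∀ {D u v w} → Reach G D u v → Reach G D v w → Reach G D u w
  reach-++ (here _) vw = vw
  reach-++ (step u∈D ux xv) vw = step u∈D ux (reach-++ xv vw)

  reach-reverse : Symmetric → ∀ {D u v} → Reach G D u v → Reach G D v u
  reach-reverse sym-G (here u∈D) = here u∈D
  reach-reverse sym-G (step u∈D ux xv) = reach-++ (reach-reverse sym-G xv) (step (reach-start xv) (sym-G ux) (here u∈D))

  path-reach : ∀ {D x xs z} → All (_∈ D) (x ∷ xs) → Linked (Adj G) (x ∷ xs)
             → z ∈ₗ (x ∷ xs) → Reach G D x z
  path-reach (x∈D ∷ _) _ (here refl) = here x∈D
  path-reach (x∈D ∷ xs⊆D) (xy ∷ path) (there z∈xs) = step x∈D xy (path-reach xs⊆D path z∈xs)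

  path-connected : Symmetric → ∀ xs → Linked (Adj G) xs → InducedConnected G ⟦ xs ⟧
  path-connected sym-G [] _ u _ u∈∅ _ = ⊥-elim (∉⊥ u∈∅)
  path-connected sym-G (x ∷ xs) path u v u∈ v∈ =
    reach-++ (reach-reverse sym-G (from-head u∈)) (from-head v∈)
    where
    from-head : ∀ {z} → z ∈ ⟦ x ∷ xs ⟧ → Reach G ⟦ x ∷ xs ⟧ x z
    from-head z∈ = path-reach (All.tabulate ∈⟦⟧⁺) path (∈⟦⟧⁻ (x ∷ xs) z∈)

  third-by-domination : ∀ {D p q m} → Dominating G D → p ∈ D → q ∈ D → q ≢ p
                      → Undominated₂ p q m → 3 ≤ ∣ D ∣
  third-by-domination {m = m} dom p∈D q∈D q≢p (¬pm , ¬qm) with dominator dom m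
  ... | z , z∈D , zm =
    three-members p∈D q∈D z∈D (≢-sym q≢p) (λ { refl → ¬pm zm }) (λ { refl → ¬qm zm })

  -- A connected set containing distinct non-adjacent p and q has a third
  -- member: the first step of a walk between them.
  third-by-connection : ∀ {D p q} → Loopless → InducedConnected G D → p ∈ D → q ∈ D → q ≢ p
                      → ¬ Adj G p q → 3 ≤ ∣ D ∣
  third-by-connection {p = p} {q} loopless con p∈D q∈D q≢p ¬pq with first-step (con p q p∈D q∈D) (≢-sym q≢p)
  ... | x , x∈D , px =
    three-members p∈D q∈D x∈D (≢-sym q≢p) (λ { refl → loopless p px }) (λ { refl → ¬pq px })

  -- If no vertex and no edge dominates G, every connected dominating set of
  -- G has at least three members.  (v₀ only witnesses that G has a vertex.)
  cds≥3 : Loopless → (∀ p → Σ (Fin n) λ w → ¬ Dom p w) → (∀ p q → Adj G p q → MissOne p q)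
        → Fin n → ∀ {D} → IsCDS G D → 3 ≤ ∣ D ∣
  cds≥3 loopless lonely edge-lonely v₀ (dom , con)
    with dominator dom v₀
  ... | p , p∈D , _
    with lonely p
  ... | w , ¬pw
    with dominator dom w
  ... | q , q∈D , qw
    with G p q Bool.≟ true
  ... | yes pq = third-by-domination dom p∈D q∈D (other-dominator ¬pw qw) (proj₂ (edge-lonely p q pq))
  ... | no ¬pq = third-by-connection loopless con p∈D q∈D (other-dominator ¬pw qw) ¬pq

  neighbour∈row : ∀ {v w} → Adj G v w → w ∈ tabulate (G v)
  neighbour∈row {v} {w} vw = lookup⇒[]= w (tabulate (G v)) (trans (lookup∘tabulate (G v) w) vw)

  mate-unique : ∀ {S} (M : Fin n → Fin n → Bool) → (∀ a b → M a b ≡ M b a)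
              → (∀ a → a ∉ S → Σ (Fin n) λ b → M a b ≡ true × (∀ c → M a c ≡ true → c ≡ b))
              → ∀ {w x y} → w ∉ S → M x w ≡ true → M y w ≡ true → x ≡ y
  mate-unique M M-sym M-perfect {w} {x} {y} w∉S xw yw with M-perfect w w∉S
  ... | _ , _ , only = trans (only x (trans (M-sym w x) xw)) (sym (only y (trans (M-sym w y) yw)))

module AddEdge {n : ℕ} (G : Graph n) (u v : Fin n) where

  G⁺ : Graph n
  G⁺ = addEdge G u v

  NewEdge : Fin n → Fin n → Set
  NewEdge a b = (a ≡ u × b ≡ v) ⊎ (a ≡ v × b ≡ u)

  ⊆G⁺ : ∀ {a b} → Adj G a b → Adj G⁺ a b
  ⊆G⁺ {a} {b} ab rewrite ab = refl

  ≟-refl : ∀ (x : Fin n) → ⌊ x ≟ x ⌋ ≡ true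
  ≟-refl x with x ≟ x
  ... | yes _ = refl
  ... | no x≢x = ⊥-elim (x≢x refl)

  uv∈G⁺ : Adj G⁺ u v
  uv∈G⁺ rewrite ≟-refl u | ≟-refl v = ∨-zeroʳ (G u v)

  vu∈G⁺ : Adj G⁺ v u
  vu∈G⁺ rewrite ≟-refl u | ≟-refl v | ∨-zeroʳ (⌊ v ≟ u ⌋ ∧ ⌊ u ≟ v ⌋) = ∨-zeroʳ (G v u)

  G⁺-edge : ∀ {a b} → Adj G⁺ a b → Adj G a b ⊎ NewEdge a b
  G⁺-edge {a} {b} ab with G a b | a ≟ u | b ≟ v | a ≟ v | b ≟ u
  ... | true  | _      | _      | _      | _      = inj₁ refl
  ... | false | yes au | yes bv | _      | _      = inj₂ (inj₁ (au , bv))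
  ... | false | _      | _      | yes av | yes bu = inj₂ (inj₂ (av , bu))
  ... | false | no _   | _      | no _   | _      = ⊥-elim (false≢true ab)
  ... | false | no _   | _      | yes _  | no _   = ⊥-elim (false≢true ab)
  ... | false | yes _  | no _   | no _   | _      = ⊥-elim (false≢true ab)
  ... | false | yes _  | no _   | yes _  | no _   = ⊥-elim (false≢true ab)

  G⁺-symmetric : Symmetric G → Symmetric G⁺
  G⁺-symmetric sym-G ab with G⁺-edge ab
  ... | inj₁ ab-old = ⊆G⁺ (sym-G ab-old)
  ... | inj₂ (inj₁ (refl , refl)) = vu∈G⁺
  ... | inj₂ (inj₂ (refl , refl)) = uv∈G⁺

  module _ (u≢v : u ≢ v) where

    G⁺-loopless : Loopless G → Loopless G⁺
    G⁺-loopless loopless a aa with G⁺-edge aa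
    ... | inj₁ aa-old = loopless a aa-old
    ... | inj₂ (inj₁ (refl , u≡v)) = u≢v u≡v
    ... | inj₂ (inj₂ (refl , v≡u)) = u≢v (sym v≡u)

    newly-dominated : ∀ {p m} → ¬ Dom G p m → Dom G⁺ p m → NewEdge m p
    newly-dominated ¬pm (inj₁ m≡p) = ⊥-elim (¬pm (inj₁ m≡p))
    newly-dominated ¬pm (inj₂ mp) with G⁺-edge mp
    ... | inj₁ mp-old = ⊥-elim (¬pm (inj₂ mp-old))
    ... | inj₂ new = new

    partner-unique : ∀ {m₁ m₂ p} → NewEdge m₁ p → NewEdge m₂ p → m₁ ≡ m₂
    partner-unique (inj₁ (refl , refl)) (inj₁ (refl , _)) = refl
    partner-unique (inj₁ (refl , refl)) (inj₂ (_ , v≡u)) = ⊥-elim (u≢v (sym v≡u))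
    partner-unique (inj₂ (refl , refl)) (inj₁ (_ , u≡v)) = ⊥-elim (u≢v u≡v)
    partner-unique (inj₂ (refl , refl)) (inj₂ (refl , _)) = refl

    crossed-partners : ∀ {m₁ m₂ p q} → NewEdge m₁ p → NewEdge m₂ q → q ≢ p → m₁ ≡ q
    crossed-partners (inj₁ (refl , refl)) (inj₁ (_ , refl)) v≢v = ⊥-elim (v≢v refl)
    crossed-partners (inj₁ (refl , refl)) (inj₂ (_ , refl)) _ = refl
    crossed-partners (inj₂ (refl , refl)) (inj₁ (_ , refl)) _ = refl
    crossed-partners (inj₂ (refl , refl)) (inj₂ (_ , refl)) u≢u = ⊥-elim (u≢u refl)

    keeps-one : ∀ {p} → VertexMissesTwo G p → Σ (Fin n) λ m → ¬ Dom G⁺ p m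
    keeps-one {p} (m₁ , m₂ , m₁≢m₂ , ¬pm₁ , ¬pm₂) with dom? G⁺ p m₁ | dom? G⁺ p m₂
    ... | no ¬pm₁⁺ | _ = m₁ , ¬pm₁⁺
    ... | yes _ | no ¬pm₂⁺ = m₂ , ¬pm₂⁺
    ... | yes pm₁⁺ | yes pm₂⁺ =
      ⊥-elim (m₁≢m₂ (partner-unique (newly-dominated ¬pm₁ pm₁⁺) (newly-dominated ¬pm₂ pm₂⁺)))

    stays-or-partner : ∀ {p q m} → Undominated₂ G p q m → Undominated₂ G⁺ p q m ⊎ (NewEdge m p ⊎ NewEdge m q)
    stays-or-partner {p} {q} {m} (¬pm , ¬qm) with dom? G⁺ p m | dom? G⁺ q m
    ... | yes pm⁺ | _ = inj₂ (inj₁ (newly-dominated ¬pm pm⁺))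
    ... | no _ | yes qm⁺ = inj₂ (inj₂ (newly-dominated ¬qm qm⁺))
    ... | no ¬pm⁺ | no ¬qm⁺ = inj₁ (¬pm⁺ , ¬qm⁺)

    keeps-one₂ : ∀ {p q} → q ≢ p → MissTwo G p q → MissOne G⁺ p q
    keeps-one₂ q≢p (_ , _ , m₁≢m₂ , und₁ , und₂) with stays-or-partner und₁ | stays-or-partner und₂
    ... | inj₁ und₁⁺ | _ = _ , und₁⁺
    ... | inj₂ _ | inj₁ und₂⁺ = _ , und₂⁺
    ... | inj₂ (inj₁ e₁) | inj₂ (inj₁ e₂) = ⊥-elim (m₁≢m₂ (partner-unique e₁ e₂))
    ... | inj₂ (inj₂ e₁) | inj₂ (inj₂ e₂) = ⊥-elim (m₁≢m₂ (partner-unique e₁ e₂))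
    ... | inj₂ (inj₁ e₁) | inj₂ (inj₂ e₂) = ⊥-elim (proj₂ und₁ (inj₁ (crossed-partners e₁ e₂ q≢p)))
    ... | inj₂ (inj₂ e₁) | inj₂ (inj₁ e₂) =
      ⊥-elim (proj₁ und₁ (inj₁ (crossed-partners e₁ e₂ (≢-sym q≢p))))

    -- the endpoints gain only each other, so what they jointly miss stays missed
    endpoints-keep : MissOne G u v → MissOne G⁺ u v
    endpoints-keep (m , ¬um , ¬vm) = m ,
      (λ um⁺ → ¬vm (inj₁ (crossed-partners (newly-dominated ¬um um⁺) (inj₁ (refl , refl)) (≢-sym u≢v))))
      , (λ vm⁺ → ¬um (inj₁ (crossed-partners (newly-dominated ¬vm vm⁺) (inj₂ (refl , refl)) u≢v)))

    cds≥3-after-edge : Loopless G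
                     → (∀ p → VertexMissesTwo G p)
                     → (∀ p q → Adj G p q → MissTwo G p q) → MissOne G u v
                     → Fin n → ∀ {D} → IsCDS G⁺ D → 3 ≤ ∣ D ∣
    cds≥3-after-edge loopless two-undom edges-miss miss-uv =
      cds≥3 G⁺ (G⁺-loopless loopless) lonely edge-lonely
      where
      lonely : ∀ p → Σ (Fin n) λ w → ¬ Dom G⁺ p w
      lonely p = keeps-one (two-undom p)
      edge-lonely : ∀ p q → Adj G⁺ p q → MissOne G⁺ p q
      edge-lonely p q pq with G⁺-edge pq
      ... | inj₁ pq-old = keeps-one₂ (λ { refl → loopless p pq-old }) (edges-miss p q pq-old)
      ... | inj₂ (inj₁ (refl , refl)) = endpoints-keep miss-uv
      ... | inj₂ (inj₂ (refl , refl)) = miss-one-swap G⁺ (endpoints-keep miss-uv)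

-- The graph X(s), for s = r + 3.  Its vertex (p , i) ∈ Fin 3 × Fin s is stored
-- as combine p i; the kinds p = 0, 1, 2 are the vertices a_i, b_i, y_i.

pattern kA = zero
pattern kB = suc zero
pattern kY = suc (suc zero)

module XGraph (r : ℕ) where

  s : ℕ
  s = suc (suc (suc r))

  N : ℕ
  N = 3 * s

  -- The graph and its vertex of kind p and index i are kept opaque: vertices
  -- are handled through their coordinates, adjacency through Edge below.
  opaque
    G : Graph N
    G = X s

    G≡X : G ≡ X s
    G≡X = refl

    vertex : Fin 3 → Fin s → Fin N
    vertex = combine

    vertex-injective : ∀ {p q i j} → vertex p i ≡ vertex q j → p ≡ q × i ≡ j
    vertex-injective {p} {q} {i} {j} eq = combine-injectiveˡ p i q j eq , combine-injectiveʳ p i q j eq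

    vertex-coordinates : ∀ u → Σ (Fin 3) λ p → Σ (Fin s) λ i → vertex p i ≡ u
    vertex-coordinates u = proj₁ (remQuot {3} s u) , proj₂ (remQuot {3} s u) , combine-remQuot {3} s u

    X-vertex : ∀ p i q j → G (vertex p i) (vertex q j) ≡ xadj p i q j
    X-vertex p i q j =
      cong₂ (λ (x y : Fin 3 × Fin s) → xadj (proj₁ x) (proj₂ x) (proj₁ y) (proj₂ y))
            (remQuot-combine p i) (remQuot-combine q j)

  kind≢ : ∀ {p q i j} → p ≢ q → vertex p i ≢ vertex q j
  kind≢ p≢q eq = p≢q (proj₁ (vertex-injective eq))

  index≢ : ∀ {p q i j} → i ≢ j → vertex p i ≢ vertex q j
  index≢ i≢j eq = i≢j (proj₂ (vertex-injective eq))

  A B Y : Fin s → Fin N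
  A = vertex kA
  B = vertex kB
  Y = vertex kY

  data View : Fin N → Set where
    vtx : ∀ p i → View (vertex p i)

  view : ∀ u → View u
  view u with vertex-coordinates u
  ... | p , i , refl = vtx p i

  data Edge : Fin 3 → Fin s → Fin 3 → Fin s → Set where
    a-b : ∀ {i j} → i ≢ j → Edge kA i kB j
    b-a : ∀ {i j} → i ≢ j → Edge kB i kA j
    a-y : ∀ {i j} → i ≢ j → Edge kA i kY j
    y-a : ∀ {i j} → i ≢ j → Edge kY i kA j
    y-y : ∀ {i j} → i ≢ j → Edge kY i kY j

  edge-index≢ : ∀ {p i q j} → Edge p i q j → i ≢ j
  edge-index≢ (a-b i≢j) = i≢j
  edge-index≢ (b-a i≢j) = i≢j
  edge-index≢ (a-y i≢j) = i≢j
  edge-index≢ (y-a i≢j) = i≢j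
  edge-index≢ (y-y i≢j) = i≢j

  no-edge-same-index : ∀ {p q i} → ¬ Edge p i q i
  no-edge-same-index e = edge-index≢ e refl

  edge-sym : ∀ {p i q j} → Edge p i q j → Edge q j p i
  edge-sym (a-b i≢j) = b-a (≢-sym i≢j)
  edge-sym (b-a i≢j) = a-b (≢-sym i≢j)
  edge-sym (a-y i≢j) = y-a (≢-sym i≢j)
  edge-sym (y-a i≢j) = a-y (≢-sym i≢j)
  edge-sym (y-y i≢j) = y-y (≢-sym i≢j)

  distinct⁺ : ∀ {i j : Fin s} → i ≢ j → not ⌊ i ≟ j ⌋ ≡ true
  distinct⁺ {i} {j} i≢j with i ≟ j
  ... | yes i≡j = ⊥-elim (i≢j i≡j)
  ... | no _ = refl

  distinct⁻ : ∀ {i j : Fin s} → not ⌊ i ≟ j ⌋ ≡ true → i ≢ j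
  distinct⁻ {i} {j} ne with i ≟ j
  ... | yes _ = ⊥-elim (false≢true ne)
  ... | no i≢j = i≢j

  xadj⇒edge : ∀ p i q j → xadj p i q j ≡ true → Edge p i q j
  xadj⇒edge kA i kB j e = a-b (distinct⁻ e)
  xadj⇒edge kB i kA j e = b-a (distinct⁻ e)
  xadj⇒edge kA i kY j e = a-y (distinct⁻ e)
  xadj⇒edge kY i kA j e = y-a (distinct⁻ e)
  xadj⇒edge kY i kY j e = y-y (distinct⁻ e)
  xadj⇒edge kA i kA j ()
  xadj⇒edge kB i kB j ()
  xadj⇒edge kB i kY j ()
  xadj⇒edge kY i kB j ()

  edge⇒xadj : ∀ {p i q j} → Edge p i q j → xadj p i q j ≡ true
  edge⇒xadj (a-b i≢j) = distinct⁺ i≢j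
  edge⇒xadj (b-a i≢j) = distinct⁺ i≢j
  edge⇒xadj (a-y i≢j) = distinct⁺ i≢j
  edge⇒xadj (y-a i≢j) = distinct⁺ i≢j
  edge⇒xadj (y-y i≢j) = distinct⁺ i≢j

  adj⇒edge : ∀ {p i q j} → Adj G (vertex p i) (vertex q j) → Edge p i q j
  adj⇒edge {p} {i} {q} {j} e = xadj⇒edge p i q j (trans (sym (X-vertex p i q j)) e)

  edge⇒adj : ∀ {p i q j} → Edge p i q j → Adj G (vertex p i) (vertex q j)
  edge⇒adj {p} {i} {q} {j} e = trans (X-vertex p i q j) (edge⇒xadj e)

  absent : ∀ {p i q j} → Edge p i q j → ¬ (G (vertex p i) (vertex q j) ≡ false)
  absent e no-edge = false≢true (trans (sym no-edge) (edge⇒adj e))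

  X-symmetric : Symmetric G
  X-symmetric {u} {v} uv with view u | view v
  ... | vtx p i | vtx q j = edge⇒adj (edge-sym (adj⇒edge uv))

  X-loopless : Loopless G
  X-loopless u uu with view u
  ... | vtx p i = no-edge-same-index (adj⇒edge uu)

  -- Since s ≥ 3, any two indices leave a third one free.
  fresh : (i j : Fin s) → Σ (Fin s) λ k → k ≢ i × k ≢ j
  fresh zero             zero             = suc zero , (λ ()) , (λ ())
  fresh zero             (suc zero)       = suc (suc zero) , (λ ()) , (λ ())
  fresh zero             (suc (suc _))    = suc zero , (λ ()) , (λ ())
  fresh (suc zero)       zero             = suc (suc zero) , (λ ()) , (λ ())
  fresh (suc zero)       (suc _)          = zero , (λ ()) , (λ ())
  fresh (suc (suc _))    zero             = suc zero , (λ ()) , (λ ())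
  fresh (suc (suc _))    (suc _)          = zero , (λ ()) , (λ ())

  other : (i : Fin s) → Σ (Fin s) λ k → k ≢ i
  other i = proj₁ (fresh i i) , proj₁ (proj₂ (fresh i i))

  two-others : (i : Fin s) → Σ (Fin s) λ j → Σ (Fin s) λ k → j ≢ i × k ≢ i × k ≢ j
  two-others i with other i
  ... | j , j≢i with fresh i j
  ...   | k , k≢i , k≢j = j , k , j≢i , k≢i , k≢j

  at-index : ∀ (P : Fin s → Set) m k → P k → (m ≢ k → P m) → P m
  at-index P m k at-k elsewhere with m ≟ k
  ... | yes refl = at-k
  ... | no m≢k = elsewhere m≢k

  undominated : ∀ {p i q j} → p ≢ q ⊎ i ≢ j → ¬ Edge p i q j → ¬ Dom G (vertex q j) (vertex p i)
  undominated (inj₁ p≢q) _ (inj₁ eq) = kind≢ p≢q eq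
  undominated (inj₂ i≢j) _ (inj₁ eq) = index≢ i≢j eq
  undominated _ ¬e (inj₂ adj) = ¬e (adj⇒edge adj)

  -- Lower bound γ_c(X(s)) ≥ 4.

  b-neighbour : ∀ {i x} → Adj G (B i) x → Σ (Fin s) λ k → x ≡ A k × k ≢ i
  b-neighbour {x = x} bx with view x
  ... | vtx q k with adj⇒edge bx
  ...   | b-a i≢k = k , refl , ≢-sym i≢k

  b-neighbour∈ : ∀ {D i x} → Adj G (B i) x → x ∈ D → Σ (Fin s) λ k → k ≢ i × A k ∈ D
  b-neighbour∈ bx x∈D with b-neighbour bx
  ... | k , refl , k≢i = k , k≢i , x∈D

  a-neighbour : ∀ {i x} → Adj G (A i) x → Σ (Fin 3) λ q → Σ (Fin s) λ k → x ≡ vertex q k × q ≢ kA × k ≢ i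
  a-neighbour {x = x} ax with view x
  ... | vtx q k with adj⇒edge ax
  ...   | a-b i≢k = kB , k , refl , (λ ()) , ≢-sym i≢k
  ...   | a-y i≢k = kY , k , refl , (λ ()) , ≢-sym i≢k

  -- Next to any member w ≠ b_i, a CDS contains some a_k with k ≠ i: either such
  -- an a_k dominates b_i, or b_i ∈ D and leaves towards w through one.
  a-in-cds : ∀ {D i w} → IsCDS G D → w ∈ D → w ≢ B i → Σ (Fin s) λ k → k ≢ i × A k ∈ D
  a-in-cds {i = i} {w} (dom , con) w∈D w≢Bi with dom (B i)
  ... | inj₂ (x , x∈D , bx) = b-neighbour∈ bx x∈D
  ... | inj₁ bi∈D with first-step G (con (B i) w bi∈D w∈D) (≢-sym w≢Bi)
  ...   | x , x∈D , bx = b-neighbour∈ bx x∈D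

  -- every CDS contains some a_i: apply a-in-cds to the dominator of b_1,
  -- which is not b_0
  first-a : ∀ {D} → IsCDS G D → Σ (Fin s) λ i → A i ∈ D
  first-a cds@(dom , _) with dominator G dom (B (suc zero))
  ... | w , w∈D , w-dom-b₁
    with a-in-cds {i = zero} cds w∈D (λ { refl → undominated (inj₂ (λ ())) (λ ()) w-dom-b₁ })
  ...   | k , _ , ak∈D = k , ak∈D

  a-exit : ∀ {D i w} → IsCDS G D → A i ∈ D → w ∈ D → w ≢ A i
         → Σ (Fin 3) λ q → Σ (Fin s) λ k → vertex q k ∈ D × q ≢ kA × k ≢ i
  a-exit {i = i} {w} (_ , con) ai∈D w∈D w≢ai with first-step G (con (A i) w ai∈D w∈D) (≢-sym w≢ai)
  ... | x , x∈D , ax with a-neighbour ax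
  ...   | q , k , refl , q≢A , k≢i = q , k , x∈D , q≢A , k≢i

  -- A CDS holds a_i and a_k (k ≠ i) and an exit x = vertex q m of a_i.  If
  -- m = k, the exit of a_k has index ≠ k, so differs from x; otherwise a_m is
  -- neither of these and its dominator is a fourth member.
  cds≥4 : ∀ {D} → IsCDS G D → 4 ≤ ∣ D ∣
  cds≥4 cds with first-a cds
  ... | i , ai∈D with a-in-cds cds ai∈D (kind≢ (λ ()))
  ... | k , k≢i , ak∈D with a-exit cds ai∈D ak∈D (index≢ k≢i)
  ... | q , m , x∈D , q≢A , m≢i with m ≟ k
  ...   | yes refl with a-exit cds ak∈D ai∈D (index≢ (≢-sym k≢i))
  ...     | q' , m' , x'∈D , q'≢A , m'≢k =
    four-members ai∈D ak∈D x∈D x'∈D (index≢ (≢-sym k≢i)) (kind≢ (≢-sym q≢A)) (kind≢ (≢-sym q'≢A))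
                 (kind≢ (≢-sym q≢A)) (kind≢ (≢-sym q'≢A)) (index≢ (≢-sym m'≢k))
  cds≥4 cds | i , ai∈D | k , k≢i , ak∈D | q , m , x∈D , q≢A , m≢i | no m≢k
    with dominator G (proj₁ cds) (A m)
  ... | _ , am∈D , inj₁ refl =
    four-members ai∈D ak∈D x∈D am∈D (index≢ (≢-sym k≢i)) (kind≢ (≢-sym q≢A)) (index≢ (≢-sym m≢i))
                 (kind≢ (≢-sym q≢A)) (index≢ (≢-sym m≢k)) (kind≢ q≢A)
  ... | z , z∈D , inj₂ am-z with a-neighbour am-z
  ...   | q″ , m″ , refl , q″≢A , m″≢m =
    four-members ai∈D ak∈D x∈D z∈D (index≢ (≢-sym k≢i)) (kind≢ (≢-sym q≢A)) (kind≢ (≢-sym q″≢A))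
                 (kind≢ (≢-sym q≢A)) (kind≢ (≢-sym q″≢A)) (index≢ (≢-sym m″≢m))

  two-undominated : ∀ p → VertexMissesTwo G p
  two-undominated u with view u
  ... | vtx kA i = B i , Y i , kind≢ (λ ()) ,
                   undominated (inj₁ (λ ())) no-edge-same-index , undominated (inj₁ (λ ())) no-edge-same-index
  ... | vtx kB i = Y zero , Y (suc zero) , index≢ (λ ()) ,
                   undominated (inj₁ (λ ())) (λ ()) , undominated (inj₁ (λ ())) (λ ())
  ... | vtx kY i = B zero , B (suc zero) , index≢ (λ ()) ,
                   undominated (inj₁ (λ ())) (λ ()) , undominated (inj₁ (λ ())) (λ ())

  miss-ab : ∀ {i j} → i ≢ j → MissTwo G (A i) (B j)
  miss-ab {i} i≢j = B i , Y i , kind≢ (λ ()) ,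
    (undominated (inj₁ (λ ())) no-edge-same-index , undominated (inj₂ i≢j) (λ ())) ,
    (undominated (inj₁ (λ ())) no-edge-same-index , undominated (inj₁ (λ ())) (λ ()))

  miss-ay : ∀ {i j} → i ≢ j → MissTwo G (A i) (Y j)
  miss-ay i≢j = A _ , B _ , kind≢ (λ ()) ,
    (undominated (inj₂ (≢-sym i≢j)) (λ ()) , undominated (inj₁ (λ ())) no-edge-same-index) ,
    (undominated (inj₁ (λ ())) no-edge-same-index , undominated (inj₁ (λ ())) (λ ()))

  miss-yy : ∀ {i j} → MissTwo G (Y i) (Y j)
  miss-yy = B zero , B (suc zero) , index≢ (λ ()) ,
    (undominated (inj₁ (λ ())) (λ ()) , undominated (inj₁ (λ ())) (λ ())) ,
    (undominated (inj₁ (λ ())) (λ ()) , undominated (inj₁ (λ ())) (λ ()))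

  edges-miss-two : ∀ p q → Adj G p q → MissTwo G p q
  edges-miss-two u v uv with view u | view v
  ... | vtx p i | vtx q j with adj⇒edge uv
  ...   | a-b i≢j = miss-ab i≢j
  ...   | b-a i≢j = miss-two-swap G (miss-ab (≢-sym i≢j))
  ...   | a-y i≢j = miss-ay i≢j
  ...   | y-a i≢j = miss-two-swap G (miss-ay (≢-sym i≢j))
  ...   | y-y _ = miss-yy

  miss-aa : ∀ {i j} → MissOne G (A i) (A j)
  miss-aa {i} {j} with fresh i j
  ... | k , k≢i , k≢j = A k , undominated (inj₂ k≢i) (λ ()) , undominated (inj₂ k≢j) (λ ())

  miss-a-b : ∀ {i} → MissOne G (A i) (B i)
  miss-a-b {i} = Y i , undominated (inj₁ (λ ())) no-edge-same-index , undominated (inj₁ (λ ())) (λ ())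

  miss-a-y : ∀ {i} → MissOne G (A i) (Y i)
  miss-a-y {i} = B i , undominated (inj₁ (λ ())) no-edge-same-index , undominated (inj₁ (λ ())) (λ ())

  miss-bb : ∀ {i j} → MissOne G (B i) (B j)
  miss-bb = Y zero , undominated (inj₁ (λ ())) (λ ()) , undominated (inj₁ (λ ())) (λ ())

  miss-by : ∀ {i j} → MissOne G (B i) (Y j)
  miss-by {i} with other i
  ... | k , k≢i = B k , undominated (inj₂ k≢i) (λ ()) , undominated (inj₁ (λ ())) (λ ())

  equal-index : ∀ {p q i j} → (∀ {i j} → i ≢ j → Edge p i q j) → G (vertex p i) (vertex q j) ≡ false → i ≡ j
  equal-index {i = i} {j} edge no-edge with i ≟ j
  ... | yes i≡j = i≡j
  ... | no i≢j = ⊥-elim (absent (edge i≢j) no-edge)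

  nonadjacent-miss : ∀ u v → NonAdj G u v → MissOne G u v
  nonadjacent-miss u v (u≢v , no-edge) with view u | view v
  ... | vtx kA i | vtx kA j = miss-aa
  ... | vtx kB i | vtx kB j = miss-bb
  ... | vtx kB i | vtx kY j = miss-by
  ... | vtx kY i | vtx kB j = miss-one-swap G miss-by
  ... | vtx kA i | vtx kB j with refl ← equal-index a-b no-edge = miss-a-b
  ... | vtx kB i | vtx kA j with refl ← equal-index b-a no-edge = miss-one-swap G miss-a-b
  ... | vtx kA i | vtx kY j with refl ← equal-index a-y no-edge = miss-a-y
  ... | vtx kY i | vtx kA j with refl ← equal-index y-a no-edge = miss-one-swap G miss-a-y
  ... | vtx kY i | vtx kY j with refl ← equal-index y-y no-edge = ⊥-elim (u≢v refl)

  Ys : Subset N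
  Ys = ⟦ map Y (allFin s) ⟧

  Y∈Ys : ∀ k → Y k ∈ Ys
  Y∈Ys k = ∈⟦⟧⁺ (∈-map⁺ Y (∈-allFin k))

  Ys⁻ : ∀ {u} → u ∈ Ys → Σ (Fin s) λ k → u ≡ Y k
  Ys⁻ {u} u∈Ys with ∈-map⁻ Y (∈⟦⟧⁻ (map Y (allFin s)) u∈Ys)
  ... | k , _ , u≡Yk = k , u≡Yk

  -- Small connected dominating sets of a symmetric supergraph G' of X(s),
  -- all built around a pair a_i, y_k with k ≠ i.
  module Around (G' : Graph N) (⊆G' : ∀ {a b} → Adj G a b → Adj G' a b) (sym' : Symmetric G') where

    adj : ∀ {p i q j} → Edge p i q j → Adj G' (vertex p i) (vertex q j)
    adj e = ⊆G' (edge⇒adj e)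

    pair-dominates : ∀ {D i k} → A i ∈ D → Y k ∈ D
                   → DominatedBy G' D (A k) → DominatedBy G' D (B i) → Dominating G' D
    pair-dominates {D} {i} {k} ai∈D yk∈D ak-dom bi-dom w with view w
    ... | vtx kA m = at-index (λ m → DominatedBy G' D (A m)) m k ak-dom
                       λ m≢k → inj₂ (Y k , yk∈D , adj (a-y m≢k))
    ... | vtx kB m = at-index (λ m → DominatedBy G' D (B m)) m i bi-dom
                       λ m≢i → inj₂ (A i , ai∈D , adj (b-a m≢i))
    ... | vtx kY m = at-index (λ m → DominatedBy G' D (Y m)) m k (inj₁ yk∈D)
                       λ m≢k → inj₂ (Y k , yk∈D , adj (y-y m≢k))

    Witness : Subset N → Set
    Witness D = IsCDS G' D × Nonempty (D ∩ Ys)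

    path-witness : ∀ {i k} xs → Linked (Adj G') xs → A i ∈ₗ xs → Y k ∈ₗ xs
                 → (Σ (Fin N) λ t → t ∈ₗ xs × Dom G' t (A k))
                 → (Σ (Fin N) λ t → t ∈ₗ xs × Dom G' t (B i)) → Witness ⟦ xs ⟧
    path-witness {k = k} xs path ai yk (t , t∈ , t-ak) (t' , t'∈ , t'-bi) =
      (pair-dominates (∈⟦⟧⁺ ai) (∈⟦⟧⁺ yk) (dominated G' (∈⟦⟧⁺ t∈) t-ak)
                      (dominated G' (∈⟦⟧⁺ t'∈) t'-bi) ,
       path-connected G' sym' xs path) ,
      (Y k , x∈p∩q⁺ (∈⟦⟧⁺ yk , Y∈Ys k))

    Small : ℕ → Set
    Small m = Σ (Subset N) λ D → IsCDS G' D × ∣ D ∣ ≤ m × Nonempty (D ∩ Ys)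

    small : ∀ xs → Witness ⟦ xs ⟧ → Small (length xs)
    small xs (cds , meets) = ⟦ xs ⟧ , cds , ∣⟦⟧∣≤length xs , meets

    via-aa : ∀ {i j} → j ≢ i → Adj G' (A i) (A j) → Small 3
    via-aa {i} {j} j≢i new = small (A i ∷ A j ∷ Y i ∷ [])
      (path-witness _ (new ∷ adj (a-y j≢i) ∷ [-]) (there (here refl)) (there (there (here refl)))
                    (A i , here refl , inj₁ refl) (A i , here refl , inj₂ (adj (b-a j≢i))))

    via-ab : ∀ {i} → Adj G' (B i) (A i) → Small 3
    via-ab {i} new with other i
    ... | k , k≢i = small (B i ∷ A i ∷ Y k ∷ [])
      (path-witness _ (new ∷ adj (a-y (≢-sym k≢i)) ∷ [-]) (there (here refl)) (there (there (here refl)))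
                    (B i , here refl , inj₂ (adj (a-b k≢i))) (B i , here refl , inj₁ refl))

    via-ay : ∀ {i} → Adj G' (Y i) (A i) → Small 3
    via-ay {i} new with other i
    ... | k , k≢i = small (A k ∷ Y i ∷ A i ∷ [])
      (path-witness _ (adj (a-y k≢i) ∷ new ∷ [-]) (here refl) (there (here refl))
                    (A i , there (there (here refl)) , inj₁ refl)
                    (A i , there (there (here refl)) , inj₂ (adj (b-a k≢i))))

    via-bb : ∀ {i j} → j ≢ i → Adj G' (B i) (B j) → Small 3
    via-bb {i} {j} j≢i new with fresh i j
    ... | k , k≢i , k≢j = small (B j ∷ A i ∷ Y k ∷ [])
      (path-witness _ (adj (b-a j≢i) ∷ adj (a-y (≢-sym k≢i)) ∷ [-]) (there (here refl)) (there (there (here refl)))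
                    (B j , here refl , inj₂ (adj (a-b k≢j))) (B j , here refl , inj₂ new))

    via-by : ∀ {i j} → Adj G' (B i) (Y j) → Small 3
    via-by {i} {j} new with fresh i j
    ... | k , k≢i , k≢j = small (A i ∷ Y k ∷ Y j ∷ [])
      (path-witness _ (adj (a-y (≢-sym k≢i)) ∷ adj (y-y k≢j) ∷ [-]) (here refl) (there (here refl))
                    (Y j , there (there (here refl)) , inj₂ (adj (a-y k≢j)))
                    (Y j , there (there (here refl)) , inj₂ new))

    after-new-edge : ∀ u v → NonAdj G u v → Adj G' u v → Small 3
    after-new-edge u v (u≢v , no-edge) uv with view u | view v
    ... | vtx kA i | vtx kA j = via-aa (λ { refl → u≢v refl }) uv
    ... | vtx kB i | vtx kB j = via-bb (λ { refl → u≢v refl }) uv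
    ... | vtx kB i | vtx kY j = via-by uv
    ... | vtx kY i | vtx kB j = via-by (sym' uv)
    ... | vtx kA i | vtx kB j with refl ← equal-index a-b no-edge = via-ab (sym' uv)
    ... | vtx kB i | vtx kA j with refl ← equal-index b-a no-edge = via-ab uv
    ... | vtx kA i | vtx kY j with refl ← equal-index a-y no-edge = via-ay (sym' uv)
    ... | vtx kY i | vtx kA j with refl ← equal-index y-a no-edge = via-ay uv
    ... | vtx kY i | vtx kY j with refl ← equal-index y-y no-edge = ⊥-elim (u≢v refl)

  open Around G (λ ab → ab) X-symmetric using (Witness; path-witness)

  standard : Fin s → Fin s → Fin s → List (Fin N)
  standard i j k = B i ∷ A j ∷ Y k ∷ A i ∷ []

  standard-witness : ∀ {i j k} → j ≢ i → k ≢ i → k ≢ j → Witness ⟦ standard i j k ⟧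
  standard-witness {i} j≢i k≢i k≢j =
    path-witness _
      (edge⇒adj (b-a (≢-sym j≢i)) ∷ edge⇒adj (a-y (≢-sym k≢j)) ∷ edge⇒adj (y-a k≢i) ∷ [-])
      (there (there (there (here refl)))) (there (there (here refl)))
      (B i , here refl , inj₂ (edge⇒adj (a-b k≢i))) (B i , here refl , inj₁ refl)

  standard-γc : ∀ {i j k} → j ≢ i → k ≢ i → k ≢ j → IsGammaCSet G ⟦ standard i j k ⟧
  standard-γc j≢i k≢i k≢j =
    proj₁ (standard-witness j≢i k≢i k≢j) , λ _ cds → ≤-trans (∣⟦⟧∣≤length (standard _ _ _)) (cds≥4 cds)

  γc≡4 : GammaC≡ G 4
  γc≡4 = (⟦ standard zero (suc zero) (suc (suc zero)) ⟧ , proj₁ witness ,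
          ≤-antisym (∣⟦⟧∣≤length (standard _ _ _)) (cds≥4 (proj₁ witness))) ,
         λ _ → cds≥4
    where
    witness : Witness ⟦ standard zero (suc zero) (suc (suc zero)) ⟧
    witness = standard-witness (λ ()) (λ ()) (λ ())

  module AfterEdge (u v : Fin N) (nonadj : NonAdj G u v) where
    open AddEdge G u v
    open Around G⁺ ⊆G⁺ (G⁺-symmetric X-symmetric) using (Small; after-new-edge)

    three-witness : Small 3
    three-witness = after-new-edge u v nonadj uv∈G⁺

    cds≥3⁺ : ∀ {D} → IsCDS G⁺ D → 3 ≤ ∣ D ∣
    cds≥3⁺ = cds≥3-after-edge (proj₁ nonadj) X-loopless two-undominated edges-miss-two
                              (nonadjacent-miss u v nonadj) (A zero)

    γc≡3 : GammaC≡ G⁺ 3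
    γc≡3 with three-witness
    ... | D , cds , ∣D∣≤3 , _ = (D , cds , ≤-antisym ∣D∣≤3 (cds≥3⁺ cds)) , λ _ → cds≥3⁺

  critical : Critical G 4
  critical = γc≡4 , λ u v nonadj → 3 , s≤s (s≤s (s≤s (s≤s z≤n))) , AfterEdge.γc≡3 u v nonadj

  Ys-clique : IsClique G Ys
  Ys-clique u v u∈Ys v∈Ys u≢v with Ys⁻ u∈Ys | Ys⁻ v∈Ys
  ... | i , refl | j , refl = edge⇒adj (y-y (λ { refl → u≢v refl }))

  -- no vertex is joined to all of Ys: vertex p i is not joined to y_i
  Ys-maximal : ∀ w → w ∉ Ys → ¬ (∀ u → u ∈ Ys → Adj G w u)
  Ys-maximal w _ joined-to-all with view w
  ... | vtx p i = no-edge-same-index (adj⇒edge (joined-to-all (Y i) (Y∈Ys i)))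

  two≤∣Ys∣ : 2 ≤ ∣ Ys ∣
  two≤∣Ys∣ = unique-members≤ (Y zero ∷ Y (suc zero) ∷ [])
              ((index≢ (λ ()) ∷ []) ∷ [] ∷ []) (Y∈Ys _ ∷ Y∈Ys _ ∷ [])

  covered : ∀ {i j k x} → j ≢ i → k ≢ i → k ≢ j → x ∈ₗ standard i j k
          → Σ (Subset N) λ D → IsGammaCSet G D × x ∈ D × Nonempty (D ∩ Ys)
  covered j≢i k≢i k≢j x∈ =
    _ , standard-γc j≢i k≢i k≢j , ∈⟦⟧⁺ x∈ , proj₂ (standard-witness j≢i k≢i k≢j)

  cover : ∀ x → Σ (Subset N) λ D → IsGammaCSet G D × x ∈ D × Nonempty (D ∩ Ys)
  cover x with view x
  ... | vtx kA i with two-others i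
  ...   | j , k , j≢i , k≢i , k≢j = covered j≢i k≢i k≢j (there (there (there (here refl))))
  cover x | vtx kB i with two-others i
  ...   | j , k , j≢i , k≢i , k≢j = covered j≢i k≢i k≢j (here refl)
  cover x | vtx kY k with two-others k
  ...   | i , j , i≢k , j≢k , j≢i = covered j≢i (≢-sym i≢k) (≢-sym j≢k) (there (there (here refl)))

  cheaper-after-edge : ∀ x y → NonAdj G x y
                     → Σ (Subset N) λ D → IsCDS (addEdge G x y) D × ∣ D ∣ < 4 × Nonempty (D ∩ Ys)
  cheaper-after-edge x y nonadj with AfterEdge.three-witness x y nonadj
  ... | D , cds , ∣D∣≤3 , meets = D , cds , s≤s ∣D∣≤3 , meets

  -- Minimum degree 2: vertex p i is joined to the partner kind at every other index.

  partner : Fin 3 → Fin 3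
  partner kA = kB
  partner kB = kA
  partner kY = kY

  partner-edge : ∀ p {i j} → i ≢ j → Edge p i (partner p) j
  partner-edge kA = a-b
  partner-edge kB = b-a
  partner-edge kY = y-y

  min-degree : MinDegreeAtLeast G 2
  min-degree v with view v
  ... | vtx p i with two-others i
  ...   | j , k , j≢i , k≢i , k≢j =
    unique-members≤ (_ ∷ _ ∷ []) ((index≢ (≢-sym k≢j) ∷ []) ∷ [] ∷ [])
      ( neighbour∈row G (edge⇒adj (partner-edge p (≢-sym j≢i)))
      ∷ neighbour∈row G (edge⇒adj (partner-edge p (≢-sym k≢i))) ∷ [])

  -- G − a_0 has no perfect matching: the s vertices b_j would be matched
  -- injectively into the s − 1 vertices a_k with k ≠ 0.
  not-1-factor-critical : ¬ FactorCritical G 1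
  not-1-factor-critical fc with fc ⁅ A zero ⁆ (∣⁅x⁆∣≡1 (A zero))
  ... | M , M-sym , M-edges , M-perfect = <-irrefl refl (injective⇒≤ slot-injective)
    where
    b∉S : ∀ j → B j ∉ ⁅ A zero ⁆
    b∉S j = x≢y⇒x∉⁅y⁆ (kind≢ (λ ()))

    mate : Fin s → Fin N
    mate j = proj₁ (M-perfect (B j) (b∉S j))

    matched : ∀ j → M (B j) (mate j) ≡ true
    matched j = proj₁ (proj₂ (M-perfect (B j) (b∉S j)))

    mate∉S : ∀ j → mate j ∉ ⁅ A zero ⁆
    mate∉S j = proj₂ (proj₂ (M-edges (B j) (mate j) (matched j)))

    index : Fin s → Fin s
    index j = proj₁ (b-neighbour (proj₁ (M-edges (B j) (mate j) (matched j))))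

    mate≡ : ∀ j → mate j ≡ A (index j)
    mate≡ j = proj₁ (proj₂ (b-neighbour (proj₁ (M-edges (B j) (mate j) (matched j)))))

    index≢0 : ∀ j → zero ≢ index j
    index≢0 j 0≡index =
      mate∉S j (subst (_∈ ⁅ A zero ⁆) (sym (trans (mate≡ j) (cong A (sym 0≡index)))) (x∈⁅x⁆ (A zero)))

    slot : Fin s → Fin (suc (suc r))
    slot j = punchOut (index≢0 j)

    slot-injective : ∀ {j j'} → slot j ≡ slot j' → j ≡ j'
    slot-injective {j} {j'} eq = proj₂ (vertex-injective (mate-unique G M M-sym M-perfect (mate∉S j) (matched j) matched'))
      where
      same-mate : mate j' ≡ mate j
      same-mate = begin
        mate j'          ≡⟨ mate≡ j' ⟩
        A (index j')     ≡⟨ cong A (sym (punchOut-injective (index≢0 j) (index≢0 j') eq)) ⟩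
        A (index j)      ≡⟨ sym (mate≡ j) ⟩
        mate j           ∎
        where open ≡-Reasoning
      matched' : M (B j') (mate j) ≡ true
      matched' = subst (λ w → M (B j') w ≡ true) same-mate (matched j')

lemma20 : (s : ℕ) → 3 ≤ s → InP 4 (X s) × InQ 4 1 (X s)
lemma20 zero                ()
lemma20 (suc zero)          (s≤s ())
lemma20 (suc (suc zero))    (s≤s (s≤s ()))
lemma20 (suc (suc (suc r))) _ =
  subst (λ H → InP 4 H × InQ 4 1 H) G≡X
    ( (critical , Ys , (Ys-clique , Ys-maximal) , two≤∣Ys∣ , cover , cheaper-after-edge)
    , (critical , min-degree , not-1-factor-critical) )
  where open XGraph r
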